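{- An elementary existential doctrine $P\colon\mathcal C^{op}\to\mathbf{InfSL}$ satisfies the Rule of Unique Choice if and only if its graph functor $\Gamma_P\colon\mathcal C\to\mathrm{Map}(\mathcal A_P)$ is full.
   Context: $\mathcal C$: cartesian category (chosen products $\times$, projections $\pi_i$, pairing $\langle-,-\rangle$, terminal $I$, diagonals $\Delta_A$, unique maps $!_A$). $\mathbf{InfSL}$: meet-semilattices with top and finite-meet-preserving maps; $P_f=P(f)$. Elementary existential doctrine: there are $\delta_A\in P(A\times A)$ such that for $e=\mathrm{id}_X\times\Delta_A$, $P_e$ has left adjoint $\exists_e(\alpha)=P_{\langle\pi_1,\pi_2\rangle}(\alpha)\wedge P_{\langle\pi_2,\pi_3\rangle}(\delta_A)$; for each product projection $\pi$, $P_\pi$ has a left adjoint $\exists_\pi$ satisfying Beck–Chevalley and Frobenius reciprocity. $\mathcal A_P$ is the cartesian bicategory with objects of $\mathcal C$, $\mathrm{Hom}(X,Y)=P(X\times Y)$, identity $\delta_X$, composite $f;g=\exists_{\langle\pi_1,\pi_3\rangle}(P_{\langle\pi_1,\pi_2\rangle}(f)\wedge P_{\langle\pi_2,\pi_3\rangle}(g))$, tensor $f\otimes g=P_{\langle\pi_1,\pi_3\rangle}(f)\wedge P_{\langle\pi_2,\pi_4\rangle}(g)$, and comonoid on $X$ given by $d_X=\Gamma_P(\Delta_X)$, $e_X=\Gamma_P(!_X)$, where the graph functor $\Gamma_P$ is the identity on objects and sends $f\colon X\to Y$ to $P_{f\times\mathrm{id}_Y}(\delta_Y)$. A map in $\mathcal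 A_P$ is an $R\colon X\to Y$ with $R;d_Y=d_X;(R\otimes R)$ and $R;e_Y=e_X$; maps form the subcategory $\mathrm{Map}(\mathcal A_P)$, and $\Gamma_P$ factors through it. $P$ satisfies the Rule of Unique Choice if for every $R\in P(X\times Y)$ which is a map in $\mathcal A_P$ there exists $f\colon X\to Y$ in $\mathcal C$ with $\top_{P(X)}\le P_{\langle\mathrm{id}_X,f\rangle}(R)$. -}

module Defs where

open import Level using (Level; _⊔_) renaming (suc to lsuc)
open import Data.Product using (Σ; _×_; _,_)
open import Relation.Binary using (Rel; IsEquivalence)
open import Relation.Binary.Lattice.Bundles using (BoundedMeetSemilattice)

record CartesianCategory (o m e : Level) : Set (lsuc (o ⊔ m ⊔ e)) where
  infixr 9 _∘_
  infix  4 _≈_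
  infixr 7 _⊗_
  field
    Obj   : Set o
    _⇒_   : Obj → Obj → Set m
    _≈_   : ∀ {A B} → Rel (A ⇒ B) e
    id    : ∀ {A} → A ⇒ A
    _∘_   : ∀ {A B C} → B ⇒ C → A ⇒ B → A ⇒ C
    ≈-equiv : ∀ {A B} → IsEquivalence (_≈_ {A} {B})
    ∘-resp-≈ : ∀ {A B C} {f f' : B ⇒ C} {g g' : A ⇒ B} →
               f ≈ f' → g ≈ g' → f ∘ g ≈ f' ∘ g'
    assoc  : ∀ {A B C D} {f : C ⇒ D} {g : B ⇒ C} {h : A ⇒ B} →
             (f ∘ g) ∘ h ≈ f ∘ (g ∘ h)
    identityˡ : ∀ {A B} {f : A ⇒ B} → id ∘ f ≈ f
    identityʳ : ∀ {A B} {f : A ⇒ B} → f ∘ id ≈ f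
    I     : Obj
    !     : ∀ {A} → A ⇒ I
    !-unique : ∀ {A} (f : A ⇒ I) → f ≈ !
    _⊗_   : Obj → Obj → Obj
    π₁    : ∀ {A B} → (A ⊗ B) ⇒ A
    π₂    : ∀ {A B} → (A ⊗ B) ⇒ B
    ⟨_,_⟩ : ∀ {A B C} → C ⇒ A → C ⇒ B → C ⇒ (A ⊗ B)
    project₁ : ∀ {A B C} {f : C ⇒ A} {g : C ⇒ B} → π₁ ∘ ⟨ f , g ⟩ ≈ f
    project₂ : ∀ {A B C} {f : C ⇒ A} {g : C ⇒ B} → π₂ ∘ ⟨ f , g ⟩ ≈ g
    ⟨⟩-unique : ∀ {A B C} {f : C ⇒ A} {g : C ⇒ B} {h : C ⇒ (A ⊗ B)} →
                π₁ ∘ h ≈ f → π₂ ∘ h ≈ g → h ≈ ⟨ f , g ⟩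

  Δ : ∀ {A} → A ⇒ (A ⊗ A)
  Δ = ⟨ id , id ⟩

  _⁂_ : ∀ {A B C D} → A ⇒ B → C ⇒ D → (A ⊗ C) ⇒ (B ⊗ D)
  f ⁂ g = ⟨ f ∘ π₁ , g ∘ π₂ ⟩

module _ {o m e : Level} (C : CartesianCategory o m e) where
  open CartesianCategory C

  record PrimaryDoctrine (c ℓ₁ ℓ₂ : Level) : Set (o ⊔ m ⊔ e ⊔ lsuc (c ⊔ ℓ₁ ⊔ ℓ₂)) where
    field
      Fib : Obj → BoundedMeetSemilattice c ℓ₁ ℓ₂

    module F (A : Obj) = BoundedMeetSemilattice (Fib A)

    Pt : Obj → Set c
    Pt A = F.Carrier A

    field
      reindex : ∀ {A B} → A ⇒ B → Pt B → Pt A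
      reindex-cong : ∀ {A B} (f : A ⇒ B) {α β : Pt B} →
                     F._≈_ B α β → F._≈_ A (reindex f α) (reindex f β)
      reindex-∧ : ∀ {A B} (f : A ⇒ B) (α β : Pt B) →
                  F._≈_ A (reindex f (F._∧_ B α β))
                          (F._∧_ A (reindex f α) (reindex f β))
      reindex-⊤ : ∀ {A B} (f : A ⇒ B) →
                  F._≈_ A (reindex f (F.⊤ B)) (F.⊤ A)
      reindex-resp-≈ : ∀ {A B} {f g : A ⇒ B} → f ≈ g → (α : Pt B) →
                       F._≈_ A (reindex f α) (reindex g α)
      reindex-id : ∀ {A} (α : Pt A) → F._≈_ A (reindex id α) α
      reindex-∘ : ∀ {A B D} (f : A ⇒ B) (g : B ⇒ D) (α : Pt D) →
                  F._≈_ A (reindex (g ∘ f) α) (reindex f (reindex g α))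

  record ElementaryExistentialDoctrine (c ℓ₁ ℓ₂ : Level)
         : Set (o ⊔ m ⊔ e ⊔ lsuc (c ⊔ ℓ₁ ⊔ ℓ₂)) where
    field
      primary : PrimaryDoctrine c ℓ₁ ℓ₂
    open PrimaryDoctrine primary public
    field
      ∃π : ∀ {X A} → Pt (X ⊗ A) → Pt X
      ∃π-adj : ∀ {X A} (α : Pt (X ⊗ A)) (β : Pt X) →
               (F._≤_ X (∃π α) β → F._≤_ (X ⊗ A) α (reindex π₁ β)) ×
               (F._≤_ (X ⊗ A) α (reindex π₁ β) → F._≤_ X (∃π α) β)
      ∃π-BC : ∀ {X' X A} (f : X' ⇒ X) (α : Pt (X ⊗ A)) →
              F._≈_ X' (∃π (reindex (f ⁂ id) α)) (reindex f (∃π α))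
      ∃π-Frob : ∀ {X A} (α : Pt (X ⊗ A)) (β : Pt X) →
                F._≈_ X (∃π (F._∧_ (X ⊗ A) (reindex π₁ β) α))
                        (F._∧_ X β (∃π α))
      -- elementary: equality predicates δ_A ∈ P(A × A) such that, for
      -- e = id_X × Δ_A : X × A → X × (A × A), P_e has left adjoint
      -- ∃_e(α) = P_⟨π₁,π₂⟩(α) ∧ P_⟨π₂,π₃⟩(δ_A)
      δ : ∀ A → Pt (A ⊗ A)
      ∃e-adj : ∀ {X A} (α : Pt (X ⊗ A)) (β : Pt (X ⊗ (A ⊗ A))) →
               let ∃eα = F._∧_ (X ⊗ (A ⊗ A))
                           (reindex ⟨ π₁ , π₁ ∘ π₂ ⟩ α)
                           (reindex π₂ (δ A))
               in (F._≤_ (X ⊗ (A ⊗ A)) ∃eα β →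
                     F._≤_ (X ⊗ A) α (reindex (id ⁂ Δ) β)) ×
                  (F._≤_ (X ⊗ A) α (reindex (id ⁂ Δ) β) →
                     F._≤_ (X ⊗ (A ⊗ A)) ∃eα β)

module _ {o m e c ℓ₁ ℓ₂ : Level} {C : CartesianCategory o m e}
         (P : ElementaryExistentialDoctrine C c ℓ₁ ℓ₂) where
  open CartesianCategory C
  open ElementaryExistentialDoctrine P

  Rel𝒜 : Obj → Obj → Set c
  Rel𝒜 X Y = Pt (X ⊗ Y)

  -- composite f ; g = ∃_⟨π₁,π₃⟩ (P_⟨π₁,π₂⟩ f ∧ P_⟨π₂,π₃⟩ g); the triple
  -- product is taken as (X × Z) × Y so that ⟨π₁,π₃⟩ is the projection π₁.
  _⨾_ : ∀ {X Y Z} → Rel𝒜 X Y → Rel𝒜 Y Z → Rel𝒜 X Z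
  _⨾_ {X} {Y} {Z} f g =
    ∃π (F._∧_ ((X ⊗ Z) ⊗ Y)
          (reindex ⟨ π₁ ∘ π₁ , π₂ ⟩ f)
          (reindex ⟨ π₂ , π₂ ∘ π₁ ⟩ g))

  _⊠_ : ∀ {X X' Y Y'} → Rel𝒜 X Y → Rel𝒜 X' Y' → Rel𝒜 (X ⊗ X') (Y ⊗ Y')
  _⊠_ {X} {X'} {Y} {Y'} f g =
    F._∧_ ((X ⊗ X') ⊗ (Y ⊗ Y'))
      (reindex ⟨ π₁ ∘ π₁ , π₁ ∘ π₂ ⟩ f)
      (reindex ⟨ π₂ ∘ π₁ , π₂ ∘ π₂ ⟩ g)

  Γ : ∀ {X Y} → X ⇒ Y → Rel𝒜 X Y
  Γ {X} {Y} f = reindex (f ⁂ id) (δ Y)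

  dup : ∀ X → Rel𝒜 X (X ⊗ X)
  dup X = Γ (Δ {X})

  del : ∀ X → Rel𝒜 X I
  del X = Γ (! {X})

  IsMap : ∀ {X Y} → Rel𝒜 X Y → Set ℓ₁
  IsMap {X} {Y} R =
    F._≈_ (X ⊗ (Y ⊗ Y)) (R ⨾ dup Y) (dup X ⨾ (R ⊠ R)) ×
    F._≈_ (X ⊗ I) (R ⨾ del Y) (del X)

  RuleOfUniqueChoice : Set (o ⊔ m ⊔ c ⊔ ℓ₁ ⊔ ℓ₂)
  RuleOfUniqueChoice =
    ∀ {X Y} (R : Rel𝒜 X Y) → IsMap R →
    Σ (X ⇒ Y) λ f → F._≤_ X (F.⊤ X) (reindex ⟨ id , f ⟩ R)

  GraphFunctorFull : Set (o ⊔ m ⊔ c ⊔ ℓ₁)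
  GraphFunctorFull =
    ∀ {X Y} (R : Rel𝒜 X Y) → IsMap R →
    Σ (X ⇒ Y) λ f → F._≈_ (X ⊗ Y) (Γ f) R

{-# OPTIONS --safe #-}
-- The equality predicate δ of P is reflexive and satisfies Leibniz's
-- substitution rule.  Reflexivity makes every graph Γ f total, and
-- substitution gives Γ f ≤ R as soon as ⊤ ≤ R(x, f x).  Conversely, the
-- comultiplicativity R ⨾ d = d ⨾ (R ⊗ R) of a map R makes it single-valued,
-- R(x,y) ∧ R(x,y') ≤ δ(y,y'), which together with ⊤ ≤ R(x, f x) gives
-- R ≤ Γ f.  So a choice function for a map R is exactly an f with Γ f ≈ R.
module Submission where

open import Level using (Level)
open import Data.Product using (_×_; _,_; proj₁; proj₂)
open import Relation.Binary using (IsEquivalence)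
import Relation.Binary.Reasoning.PartialOrder as PosetReasoning
import Relation.Binary.Lattice.Properties.MeetSemilattice as MeetSemilatticeProperties

open import Defs

module Cartesian {o m e : Level} (C : CartesianCategory o m e) where
  open CartesianCategory C

  module ≈ {A B : Obj} = IsEquivalence (≈-equiv {A} {B})

  ∘-congˡ : ∀ {A B D} {f f' : B ⇒ D} {g : A ⇒ B} → f ≈ f' → f ∘ g ≈ f' ∘ g
  ∘-congˡ p = ∘-resp-≈ p ≈.refl

  ∘-congʳ : ∀ {A B D} {f : B ⇒ D} {g g' : A ⇒ B} → g ≈ g' → f ∘ g ≈ f ∘ g'
  ∘-congʳ p = ∘-resp-≈ ≈.refl p

  ⟨⟩-cong₂ : ∀ {A B D} {f f' : D ⇒ A} {g g' : D ⇒ B} →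
             f ≈ f' → g ≈ g' → ⟨ f , g ⟩ ≈ ⟨ f' , g' ⟩
  ⟨⟩-cong₂ p q = ⟨⟩-unique (≈.trans project₁ p) (≈.trans project₂ q)

  ⟨⟩∘ : ∀ {A B D Z} {f : D ⇒ A} {g : D ⇒ B} {h : Z ⇒ D} →
        ⟨ f , g ⟩ ∘ h ≈ ⟨ f ∘ h , g ∘ h ⟩
  ⟨⟩∘ = ⟨⟩-unique (≈.trans (≈.sym assoc) (∘-congˡ project₁))
                  (≈.trans (≈.sym assoc) (∘-congˡ project₂))

  ⟨π₁,π₂⟩≈id : ∀ {A B} → ⟨ π₁ , π₂ ⟩ ≈ id {A ⊗ B}
  ⟨π₁,π₂⟩≈id = ≈.sym (⟨⟩-unique identityʳ identityʳ)

  ∘π₁∘⟨⟩ : ∀ {A B D Z} {u : A ⇒ Z} {a : D ⇒ A} {b : D ⇒ B} →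
           (u ∘ π₁) ∘ ⟨ a , b ⟩ ≈ u ∘ a
  ∘π₁∘⟨⟩ = ≈.trans assoc (∘-congʳ project₁)

  ∘π₂∘⟨⟩ : ∀ {A B D Z} {u : B ⇒ Z} {a : D ⇒ A} {b : D ⇒ B} →
           (u ∘ π₂) ∘ ⟨ a , b ⟩ ≈ u ∘ b
  ∘π₂∘⟨⟩ = ≈.trans assoc (∘-congʳ project₂)

  ⁂∘⟨⟩ : ∀ {A B A' B' D} {u : A ⇒ A'} {v : B ⇒ B'} {a : D ⇒ A} {b : D ⇒ B} →
         (u ⁂ v) ∘ ⟨ a , b ⟩ ≈ ⟨ u ∘ a , v ∘ b ⟩
  ⁂∘⟨⟩ = ≈.trans ⟨⟩∘ (⟨⟩-cong₂ ∘π₁∘⟨⟩ ∘π₂∘⟨⟩)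

  Δ∘ : ∀ {A D} {h : D ⇒ A} → Δ ∘ h ≈ ⟨ h , h ⟩
  Δ∘ = ≈.trans ⟨⟩∘ (⟨⟩-cong₂ identityˡ identityˡ)

module _ {o m e c ℓ₁ ℓ₂ : Level} {C : CartesianCategory o m e}
         (P : ElementaryExistentialDoctrine C c ℓ₁ ℓ₂) where
  open CartesianCategory C
  open Cartesian C
  open ElementaryExistentialDoctrine P

  infix 4 Leq Eq
  infixr 7 Meet

  Leq : (A : Obj) → Pt A → Pt A → Set ℓ₂
  Leq A = F._≤_ A
  syntax Leq A x y = x ≤[ A ] y

  Eq : (A : Obj) → Pt A → Pt A → Set ℓ₁
  Eq A = F._≈_ A
  syntax Eq A x y = x ≈[ A ] y

  Meet : (A : Obj) → Pt A → Pt A → Pt A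
  Meet A = F._∧_ A
  syntax Meet A x y = x ∧[ A ] y

  module ≤-Reasoning (A : Obj) = PosetReasoning (F.poset A)
  module Meets (A : Obj) = MeetSemilatticeProperties (F.meetSemilattice A)

  reindex-mono : ∀ {A B} (f : A ⇒ B) {x y : Pt B} →
                 x ≤[ B ] y → reindex f x ≤[ A ] reindex f y
  reindex-mono {A} {B} f {x} {y} x≤y = begin
    reindex f x                     ≈⟨ reindex-cong f (Meets.y≤x⇒x∧y≈y B x≤y) ⟨
    reindex f (y ∧[ B ] x)          ≈⟨ reindex-∧ f y x ⟩
    reindex f y ∧[ A ] reindex f x  ≤⟨ F.x∧y≤x A _ _ ⟩
    reindex f y                     ∎
    where open ≤-Reasoning A

  reindex-∘≈ : ∀ {A B D} {f : A ⇒ B} {g : B ⇒ D} {h : A ⇒ D} → g ∘ f ≈ h →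
               (α : Pt D) → reindex f (reindex g α) ≈[ A ] reindex h α
  reindex-∘≈ {A} {f = f} {g} g∘f≈h α =
    F.Eq.trans A (F.Eq.sym A (reindex-∘ f g α)) (reindex-resp-≈ g∘f≈h α)

  reindex-⟨π₁,π₂⟩ : ∀ {A B} (α : Pt (A ⊗ B)) → reindex ⟨ π₁ , π₂ ⟩ α ≈[ A ⊗ B ] α
  reindex-⟨π₁,π₂⟩ {A} {B} α =
    F.Eq.trans (A ⊗ B) (reindex-resp-≈ ⟨π₁,π₂⟩≈id α) (reindex-id α)

  ⊤≤-reindex : ∀ {A B} (f : A ⇒ B) {x : Pt B} →
               F.⊤ B ≤[ B ] x → F.⊤ A ≤[ A ] reindex f x
  ⊤≤-reindex {A} {B} f ⊤≤x =
    F.trans A (F.reflexive A (F.Eq.sym A (reindex-⊤ f))) (reindex-mono f ⊤≤x)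

  ⊤≤⇒∧-greatest : (A : Obj) {x y z : Pt A} →
                  F.⊤ A ≤[ A ] x → y ≤[ A ] z → y ≤[ A ] x ∧[ A ] z
  ⊤≤⇒∧-greatest A ⊤≤x y≤z = F.∧-greatest A (F.trans A (F.maximum A _) ⊤≤x) y≤z

  δ-refl : ∀ {W A} (a : W ⇒ A) → F.⊤ W ≤[ W ] reindex ⟨ a , a ⟩ (δ A)
  δ-refl {W} {A} a =
    F.trans W (⊤≤-reindex ⟨ id , a ⟩ on-diagonal)
              (F.reflexive W (reindex-∘≈ (≈.trans ⟨⟩∘ (⟨⟩-cong₂ project₂ project₂)) (δ A)))
    where
    ⊤ = F.⊤ (W ⊗ A)
    ∃e⊤ = reindex ⟨ π₁ , π₁ ∘ π₂ ⟩ ⊤ ∧[ W ⊗ (A ⊗ A) ] reindex π₂ (δ A)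
    open ≤-Reasoning (W ⊗ A)
    on-diagonal : ⊤ ≤[ W ⊗ A ] reindex ⟨ π₂ , π₂ ⟩ (δ A)
    on-diagonal = begin
      ⊤                                    ≤⟨ proj₁ (∃e-adj ⊤ ∃e⊤) (F.refl _) ⟩
      reindex (id ⁂ Δ) ∃e⊤                 ≤⟨ reindex-mono (id ⁂ Δ) (F.x∧y≤y _ _ _) ⟩
      reindex (id ⁂ Δ) (reindex π₂ (δ A))  ≈⟨ reindex-∘≈ (≈.trans project₂ Δ∘) (δ A) ⟩
      reindex ⟨ π₂ , π₂ ⟩ (δ A)            ∎

  δ-subst : ∀ {W X A} (α : Pt (X ⊗ A)) (p : W ⇒ X) (a b : W ⇒ A) →
            reindex ⟨ p , a ⟩ α ∧[ W ] reindex ⟨ a , b ⟩ (δ A) ≤[ W ] reindex ⟨ p , b ⟩ α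
  δ-subst {W} {X} {A} α p a b = begin
    reindex ⟨ p , a ⟩ α ∧[ W ] reindex ⟨ a , b ⟩ (δ A)
      ≈⟨ Meets.∧-cong W (reindex-∘≈ t-fst α) (reindex-∘≈ project₂ (δ A)) ⟨
    reindex t (reindex ⟨ π₁ , π₁ ∘ π₂ ⟩ α) ∧[ W ] reindex t (reindex π₂ (δ A))
      ≈⟨ reindex-∧ t _ _ ⟨
    reindex t ∃eα
      ≤⟨ reindex-mono t ∃eα≤β ⟩
    reindex t β
      ≈⟨ reindex-∘≈ t-snd α ⟩
    reindex ⟨ p , b ⟩ α ∎
    where
    open ≤-Reasoning W
    t : W ⇒ (X ⊗ (A ⊗ A))
    t = ⟨ p , ⟨ a , b ⟩ ⟩
    ∃eα = reindex ⟨ π₁ , π₁ ∘ π₂ ⟩ α ∧[ X ⊗ (A ⊗ A) ] reindex π₂ (δ A)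
    β = reindex ⟨ π₁ , π₂ ∘ π₂ ⟩ α
    t-fst : ⟨ π₁ , π₁ ∘ π₂ ⟩ ∘ t ≈ ⟨ p , a ⟩
    t-fst = ≈.trans ⟨⟩∘ (⟨⟩-cong₂ project₁ (≈.trans ∘π₂∘⟨⟩ project₁))
    t-snd : ⟨ π₁ , π₂ ∘ π₂ ⟩ ∘ t ≈ ⟨ p , b ⟩
    t-snd = ≈.trans ⟨⟩∘ (⟨⟩-cong₂ project₁ (≈.trans ∘π₂∘⟨⟩ project₂))
    -- β restricted along id ⁂ Δ is α again, so the adjunction ∃_e ⊣ P_{id⁂Δ} applies.
    β-on-diagonal : ⟨ π₁ , π₂ ∘ π₂ ⟩ ∘ (id ⁂ Δ) ≈ id {X ⊗ A}
    β-on-diagonal = ≈.trans ⟨⟩∘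
      (≈.trans (⟨⟩-cong₂ (≈.trans project₁ identityˡ)
                         (≈.trans ∘π₂∘⟨⟩ (≈.trans (∘-congʳ Δ∘) project₂)))
               ⟨π₁,π₂⟩≈id)
    ∃eα≤β : ∃eα ≤[ X ⊗ (A ⊗ A) ] β
    ∃eα≤β = proj₂ (∃e-adj α β)
      (F.reflexive _ (F.Eq.sym _ (F.Eq.trans _ (reindex-∘≈ β-on-diagonal α) (reindex-id α))))

  δ-transport : ∀ {W A} (β : Pt A) (a b : W ⇒ A) →
                reindex a β ∧[ W ] reindex ⟨ a , b ⟩ (δ A) ≤[ W ] reindex b β
  δ-transport {W} {A} β a b = begin
    reindex a β ∧[ W ] reindex ⟨ a , b ⟩ (δ A)
      ≈⟨ Meets.∧-cong W (reindex-∘≈ project₂ β) (F.Eq.refl W) ⟨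
    reindex ⟨ id , a ⟩ (reindex π₂ β) ∧[ W ] reindex ⟨ a , b ⟩ (δ A)
      ≤⟨ δ-subst (reindex π₂ β) id a b ⟩
    reindex ⟨ id , b ⟩ (reindex π₂ β)
      ≈⟨ reindex-∘≈ project₂ β ⟩
    reindex b β ∎
    where open ≤-Reasoning W

  Γ-total : ∀ {A B} (g : A ⇒ B) → F.⊤ A ≤[ A ] reindex ⟨ id , g ⟩ (Γ P g)
  Γ-total {A} {B} g = F.trans A (δ-refl g)
    (F.reflexive A (F.Eq.sym A (reindex-∘≈ (≈.trans ⁂∘⟨⟩ (⟨⟩-cong₂ identityʳ identityˡ)) (δ B))))

  Γ≈reindex-δ : ∀ {A B} (g : A ⇒ B) → Γ P g ≈[ A ⊗ B ] reindex ⟨ g ∘ π₁ , π₂ ⟩ (δ B)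
  Γ≈reindex-δ {B = B} g = reindex-resp-≈ (⟨⟩-cong₂ ≈.refl identityˡ) (δ B)

  ⊤≤-reindex-along : ∀ {W X Y} {R : Rel𝒜 P X Y} {f : X ⇒ Y} →
                     F.⊤ X ≤[ X ] reindex ⟨ id , f ⟩ R →
                     (w : W ⇒ X) → F.⊤ W ≤[ W ] reindex ⟨ w , f ∘ w ⟩ R
  ⊤≤-reindex-along {W} {R = R} ⊤≤R⟨id,f⟩ w = F.trans W (⊤≤-reindex w ⊤≤R⟨id,f⟩)
    (F.reflexive W (reindex-∘≈ (≈.trans ⟨⟩∘ (⟨⟩-cong₂ identityˡ ≈.refl)) R))

  ⨾-intro : ∀ {W X Y Z} (S : Rel𝒜 P X Y) (T : Rel𝒜 P Y Z)
            (x : W ⇒ X) (y : W ⇒ Y) (z : W ⇒ Z) →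
            reindex ⟨ x , y ⟩ S ∧[ W ] reindex ⟨ y , z ⟩ T
              ≤[ W ] reindex ⟨ x , z ⟩ (_⨾_ P S T)
  ⨾-intro {W} {X} {Y} {Z} S T x y z = begin
    reindex ⟨ x , y ⟩ S ∧[ W ] reindex ⟨ y , z ⟩ T
      ≈⟨ Meets.∧-cong W (reindex-∘≈ s-fst S) (reindex-∘≈ s-snd T) ⟨
    reindex s (reindex ⟨ π₁ ∘ π₁ , π₂ ⟩ S) ∧[ W ] reindex s (reindex ⟨ π₂ , π₂ ∘ π₁ ⟩ T)
      ≈⟨ reindex-∧ s _ _ ⟨
    reindex s ψ
      ≤⟨ reindex-mono s (proj₁ (∃π-adj ψ (∃π ψ)) (F.refl _)) ⟩
    reindex s (reindex π₁ (∃π ψ))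
      ≈⟨ reindex-∘≈ project₁ (∃π ψ) ⟩
    reindex ⟨ x , z ⟩ (_⨾_ P S T) ∎
    where
    open ≤-Reasoning W
    s : W ⇒ ((X ⊗ Z) ⊗ Y)
    s = ⟨ ⟨ x , z ⟩ , y ⟩
    ψ = reindex ⟨ π₁ ∘ π₁ , π₂ ⟩ S ∧[ (X ⊗ Z) ⊗ Y ] reindex ⟨ π₂ , π₂ ∘ π₁ ⟩ T
    s-fst : ⟨ π₁ ∘ π₁ , π₂ ⟩ ∘ s ≈ ⟨ x , y ⟩
    s-fst = ≈.trans ⟨⟩∘ (⟨⟩-cong₂ (≈.trans ∘π₁∘⟨⟩ project₁) project₂)
    s-snd : ⟨ π₂ , π₂ ∘ π₁ ⟩ ∘ s ≈ ⟨ y , z ⟩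
    s-snd = ≈.trans ⟨⟩∘ (⟨⟩-cong₂ project₂ (≈.trans ∘π₁∘⟨⟩ project₂))

  ⊠-reindex : ∀ {W X X' Y Y'} (S : Rel𝒜 P X Y) (T : Rel𝒜 P X' Y')
              (x : W ⇒ X) (x' : W ⇒ X') (y : W ⇒ Y) (y' : W ⇒ Y') →
              reindex ⟨ ⟨ x , x' ⟩ , ⟨ y , y' ⟩ ⟩ (_⊠_ P S T)
                ≈[ W ] reindex ⟨ x , y ⟩ S ∧[ W ] reindex ⟨ x' , y' ⟩ T
  ⊠-reindex {W} S T x x' y y' = F.Eq.trans W (reindex-∧ _ _ _)
    (Meets.∧-cong W
      (reindex-∘≈ (≈.trans ⟨⟩∘ (⟨⟩-cong₂ (≈.trans ∘π₁∘⟨⟩ project₁) (≈.trans ∘π₂∘⟨⟩ project₁))) S)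
      (reindex-∘≈ (≈.trans ⟨⟩∘ (⟨⟩-cong₂ (≈.trans ∘π₁∘⟨⟩ project₂) (≈.trans ∘π₂∘⟨⟩ project₂))) T))

  ⨾-dup≤δ : ∀ {X Y} (R : Rel𝒜 P X Y) →
            _⨾_ P R (dup P Y) ≤[ X ⊗ (Y ⊗ Y) ] reindex π₂ (δ Y)
  ⨾-dup≤δ {X} {Y} R = proj₂ (∃π-adj ψ (reindex π₂ (δ Y))) (begin
    ψ
      ≤⟨ F.x∧y≤y W _ _ ⟩
    reindex ⟨ π₂ , π₂ ∘ π₁ ⟩ (dup P Y)
      ≈⟨ reindex-∘≈ (≈.trans ⁂∘⟨⟩ (⟨⟩-cong₂ Δ∘ identityˡ)) (δ (Y ⊗ Y)) ⟩
    reindex ⟨ ⟨ π₂ , π₂ ⟩ , π₂ ∘ π₁ ⟩ (δ (Y ⊗ Y))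
      ≤⟨ ⊤≤⇒∧-greatest W (δ-refl π₂) (F.refl W) ⟩
    reindex ⟨ π₂ , π₂ ⟩ (δ Y) ∧[ W ] reindex ⟨ ⟨ π₂ , π₂ ⟩ , π₂ ∘ π₁ ⟩ (δ (Y ⊗ Y))
      ≤⟨ δ-transport (δ Y) ⟨ π₂ , π₂ ⟩ (π₂ ∘ π₁) ⟩
    reindex (π₂ ∘ π₁) (δ Y)
      ≈⟨ reindex-∘ π₁ π₂ (δ Y) ⟩
    reindex π₁ (reindex π₂ (δ Y)) ∎)
    where
    W = (X ⊗ (Y ⊗ Y)) ⊗ Y
    ψ = reindex ⟨ π₁ ∘ π₁ , π₂ ⟩ R ∧[ W ] reindex ⟨ π₂ , π₂ ∘ π₁ ⟩ (dup P Y)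
    open ≤-Reasoning W

  single-valued : ∀ {W X Y} {R : Rel𝒜 P X Y} →
                  _⨾_ P (dup P X) (_⊠_ P R R) ≤[ X ⊗ (Y ⊗ Y) ] _⨾_ P R (dup P Y) →
                  (x : W ⇒ X) (y y' : W ⇒ Y) →
                  reindex ⟨ x , y ⟩ R ∧[ W ] reindex ⟨ x , y' ⟩ R ≤[ W ] reindex ⟨ y , y' ⟩ (δ Y)
  single-valued {W} {X} {Y} {R} d⨾R⊠R≤R⨾d x y y' = begin
    reindex ⟨ x , y ⟩ R ∧[ W ] reindex ⟨ x , y' ⟩ R
      ≈⟨ F.Eq.trans W (reindex-resp-≈ (⟨⟩-cong₂ Δ∘ ≈.refl) (_⊠_ P R R)) (⊠-reindex R R x x y y') ⟨
    reindex ⟨ Δ ∘ x , ⟨ y , y' ⟩ ⟩ (_⊠_ P R R)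
      ≤⟨ ⊤≤⇒∧-greatest W (⊤≤-reindex-along (Γ-total Δ) x) (F.refl W) ⟩
    reindex ⟨ x , Δ ∘ x ⟩ (dup P X) ∧[ W ] reindex ⟨ Δ ∘ x , ⟨ y , y' ⟩ ⟩ (_⊠_ P R R)
      ≤⟨ ⨾-intro (dup P X) (_⊠_ P R R) x (Δ ∘ x) ⟨ y , y' ⟩ ⟩
    reindex ⟨ x , ⟨ y , y' ⟩ ⟩ (_⨾_ P (dup P X) (_⊠_ P R R))
      ≤⟨ reindex-mono _ (F.trans _ d⨾R⊠R≤R⨾d (⨾-dup≤δ R)) ⟩
    reindex ⟨ x , ⟨ y , y' ⟩ ⟩ (reindex π₂ (δ Y))
      ≈⟨ reindex-∘≈ project₂ (δ Y) ⟩
    reindex ⟨ y , y' ⟩ (δ Y) ∎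
    where open ≤-Reasoning W

  Γ≤-of-total : ∀ {X Y} {R : Rel𝒜 P X Y} {f : X ⇒ Y} →
                F.⊤ X ≤[ X ] reindex ⟨ id , f ⟩ R → Γ P f ≤[ X ⊗ Y ] R
  Γ≤-of-total {X} {Y} {R} {f} ⊤≤R⟨id,f⟩ = begin
    Γ P f
      ≈⟨ Γ≈reindex-δ f ⟩
    reindex ⟨ f ∘ π₁ , π₂ ⟩ (δ Y)
      ≤⟨ ⊤≤⇒∧-greatest (X ⊗ Y) (⊤≤-reindex-along ⊤≤R⟨id,f⟩ π₁) (F.refl (X ⊗ Y)) ⟩
    reindex ⟨ π₁ , f ∘ π₁ ⟩ R ∧[ X ⊗ Y ] reindex ⟨ f ∘ π₁ , π₂ ⟩ (δ Y)
      ≤⟨ δ-subst R π₁ (f ∘ π₁) π₂ ⟩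
    reindex ⟨ π₁ , π₂ ⟩ R
      ≈⟨ reindex-⟨π₁,π₂⟩ R ⟩
    R ∎
    where open ≤-Reasoning (X ⊗ Y)

  ≤Γ-of-single-valued : ∀ {X Y} {R : Rel𝒜 P X Y} {f : X ⇒ Y} →
                        _⨾_ P (dup P X) (_⊠_ P R R) ≤[ X ⊗ (Y ⊗ Y) ] _⨾_ P R (dup P Y) →
                        F.⊤ X ≤[ X ] reindex ⟨ id , f ⟩ R → R ≤[ X ⊗ Y ] Γ P f
  ≤Γ-of-single-valued {X} {Y} {R} {f} d⨾R⊠R≤R⨾d ⊤≤R⟨id,f⟩ = begin
    R
      ≤⟨ ⊤≤⇒∧-greatest (X ⊗ Y) (⊤≤-reindex-along ⊤≤R⟨id,f⟩ π₁)
                               (F.reflexive (X ⊗ Y) (F.Eq.sym (X ⊗ Y) (reindex-⟨π₁,π₂⟩ R))) ⟩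
    reindex ⟨ π₁ , f ∘ π₁ ⟩ R ∧[ X ⊗ Y ] reindex ⟨ π₁ , π₂ ⟩ R
      ≤⟨ single-valued d⨾R⊠R≤R⨾d π₁ (f ∘ π₁) π₂ ⟩
    reindex ⟨ f ∘ π₁ , π₂ ⟩ (δ Y)
      ≈⟨ Γ≈reindex-δ f ⟨
    Γ P f ∎
    where open ≤-Reasoning (X ⊗ Y)

  RuleOfUniqueChoice⇒GraphFunctorFull : RuleOfUniqueChoice P → GraphFunctorFull P
  RuleOfUniqueChoice⇒GraphFunctorFull ruc {X} {Y} R isMap@(comultiplicative , _)
    with ruc R isMap
  ... | f , ⊤≤R⟨id,f⟩ = f , F.antisym (X ⊗ Y) (Γ≤-of-total ⊤≤R⟨id,f⟩)
    (≤Γ-of-single-valued (F.reflexive _ (F.Eq.sym _ comultiplicative)) ⊤≤R⟨id,f⟩)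

  GraphFunctorFull⇒RuleOfUniqueChoice : GraphFunctorFull P → RuleOfUniqueChoice P
  GraphFunctorFull⇒RuleOfUniqueChoice full {X} R isMap with full R isMap
  ... | f , Γf≈R = f , F.trans X (Γ-total f) (F.reflexive X (reindex-cong ⟨ id , f ⟩ Γf≈R))

propositionD2 : ∀ {o m e c ℓ₁ ℓ₂} {C : CartesianCategory o m e}
                  (P : ElementaryExistentialDoctrine C c ℓ₁ ℓ₂) →
                  (RuleOfUniqueChoice P → GraphFunctorFull P) ×
                  (GraphFunctorFull P → RuleOfUniqueChoice P)
propositionD2 P = RuleOfUniqueChoice⇒GraphFunctorFull P , GraphFunctorFull⇒RuleOfUniqueChoice P
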